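{- Let $n\geq r\geq 3$ and $t\geq 3$ be integers, and let $H$ be a linear $r$-graph with $n$ vertices. Let $u,w\in V(H)$ be two adjacent vertices and let $v\in N_u(H)\setminus\{w\}$. Suppose $W\subseteq N_{vuw}\setminus(l_{vu}\cup l_{vw}\cup l_{uw})$ is such that any two distinct vertices $u_1,u_2\in W$ satisfy $l_{vu_1}\neq l_{vu_2}$. If $|W|\geq (t-1)(r-1)+1$, then $H$ contains a Berge-$K_{3,t}$.
   Context: An $r$-graph $H$ has edges that are $r$-element subsets of $V(H)$; it is linear if any two distinct edges share at most one vertex. Two vertices are adjacent if some edge contains both; $N_x(H)$ is the set of vertices adjacent to $x$, and $N_{x_1\cdots x_k}=N_{x_1}(H)\cap\cdots\cap N_{x_k}(H)$. For adjacent vertices $a,b$, $l_{ab}$ denotes the unique edge containing both $a$ and $b$ (unique by linearity); if $a,b$ are not adjacent, $l_{ab}=\emptyset$. For a simple graph $F$, a hypergraph is a Berge-$F$ if there is a bijection $\phi:E(F)\to E$ from the edges of $F$ to its edges with $e\subseteq\phi(e)$ for all $e\in E(F)$; $H$ contains a Berge-$F$ if some subset of $E(H)$ forms a Berge-$F$. $K_{3,t}$ is the complete bipartite graph with parts of sizes $3$ and $t$. -}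

module Defs where

open import Data.Nat using (ℕ; _≤_)
open import Data.Fin using (Fin)
open import Data.Fin.Subset using (Subset; _∈_; _∉_; _∩_; ∣_∣)
open import Data.Product using (Σ; ∃; _×_)
open import Relation.Binary.PropositionalEquality using (_≡_; _≢_)
open import Relation.Nullary using (¬_)
open import Function.Definitions using (Injective)

record Hypergraph (n r : ℕ) : Set where
  field
    m        : ℕ
    edge     : Fin m → Subset n
    distinct : Injective _≡_ _≡_ edge
    uniform  : ∀ i → ∣ edge i ∣ ≡ r
open Hypergraph public

Linear : ∀ {n r} → Hypergraph n r → Set
Linear H = ∀ i j → i ≢ j → ∣ edge H i ∩ edge H j ∣ ≤ 1

Adjacent : ∀ {n r} → Hypergraph n r → Fin n → Fin n → Set
Adjacent H x y = x ≢ y × ∃ λ i → x ∈ edge H i × y ∈ edge H i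

InN : ∀ {n r} → Hypergraph n r → Fin n → Fin n → Set
InN H x y = Adjacent H x y

-- edge i is l_ab (an edge containing both a and b; unique when H is linear
-- and a ≠ b).  If a, b are not adjacent no edge satisfies this (l_ab = ∅).
IsL : ∀ {n r} → (H : Hypergraph n r) → Fin n → Fin n → Fin (m H) → Set
IsL H a b i = a ≢ b × a ∈ edge H i × b ∈ edge H i

InL : ∀ {n r} → Hypergraph n r → Fin n → Fin n → Fin n → Set
InL H a b y = ∃ λ i → IsL H a b i × y ∈ edge H i

ContainsBergeK3 : ∀ {n r} → Hypergraph n r → ℕ → Set
ContainsBergeK3 {n} H t =
  Σ (Fin 3 → Fin n) λ a → Σ (Fin t → Fin n) λ b →
  Σ (Fin 3 → Fin t → Fin (m H)) λ φ →
    Injective _≡_ _≡_ a × Injective _≡_ _≡_ b ×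
    (∀ i j → a i ≢ b j) ×
    (∀ i j i' j' → φ i j ≡ φ i' j' → i ≡ i' × j ≡ j') ×
    (∀ i j → a i ∈ edge H (φ i j) × b j ∈ edge H (φ i j))

module Submission where

-- For x ∈ W pick edges l_ux ∋ u, x and l_wx ∋ w, x.  Viewing x as an edge joining l_ux to l_wx gives
-- a bipartite multigraph in which every vertex has degree at most r - 1: an edge through u meets W
-- in at most r - 1 vertices.  By König's theorem (in Rizzi's inductive proof) a maximum matching is
-- as large as a minimum vertex cover, and t - 1 cover vertices meet at most (t - 1)(r - 1) < |W|
-- edges.  So some x_1, ..., x_t ∈ W have pairwise distinct l_ux_j and pairwise distinct l_wx_j; the
-- l_vx_j are distinct by hypothesis, and x_j ∉ l_vu ∪ l_vw ∪ l_uw separates edges through different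
-- centres.  The 3t edges l_zx_j with z ∈ {v, u, w} form the Berge-K_{3,t}.

open import Defs
open import Data.Nat using (ℕ; zero; suc; _≤_; _<_; _+_; _*_; _∸_; z≤n; s≤s; s≤s⁻¹; pred)
open import Data.Nat.Properties
open import Data.Fin using (Fin; zero; suc; inject≤) renaming (_≟_ to _≟ᶠ_)
open import Data.Fin.Properties using (inject≤-injective)
open import Data.List using (List; []; _∷_; length; filter; lookup; map; allFin; tabulate)
open import Data.List.Properties using (filter-notAll; length-map; map-tabulate)
open import Data.List.Membership.Propositional.Properties using (∈-filter⁺; ∈-filter⁻; ∈-lookup)
open import Data.List.Relation.Unary.Any using (here; there; any?)
open import Data.List.Relation.Unary.All as All using (All)
open import Data.List.Relation.Unary.AllPairs as AllPairs using (AllPairs; []; _∷_)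
open import Data.List.Relation.Unary.Unique.Propositional using (Unique)
open import Data.List.Relation.Unary.Unique.Propositional.Properties as Unique using (allFin⁺)
open import Data.List.Relation.Binary.Sublist.Propositional.Properties using (filter⁺; filter-⊆; length-mono-≤)
open import Data.Vec.Base using (_∷_; [])
open import Data.Product using (Σ; ∃; _×_; _,_; proj₁; proj₂)
open import Data.Sum as Sum using (_⊎_; inj₁; inj₂)
open import Data.Empty using (⊥-elim)
open import Function using (_∘_)
open import Function.Definitions using (Injective)
open import Relation.Nullary using (¬_; yes; no; ¬?; contradiction)
open import Relation.Nullary.Decidable using (_×-dec_)
open import Relation.Unary using (Decidable)
open import Relation.Unary.Properties using (∁?)
open import Relation.Binary.Definitions using (DecidableEquality; Symmetric)
open import Relation.Binary.PropositionalEquality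
  using (_≡_; _≢_; refl; sym; trans; cong; subst; ≢-sym; module ≡-Reasoning)

length-filter+filter-∁ : ∀ {A : Set} {P : A → Set} (P? : Decidable P) xs →
  length (filter P? xs) + length (filter (∁? P?) xs) ≡ length xs
length-filter+filter-∁ P? [] = refl
length-filter+filter-∁ P? (x ∷ xs) with P? x
... | yes _ = cong suc (length-filter+filter-∁ P? xs)
... | no _ = trans (+-suc _ _) (cong suc (length-filter+filter-∁ P? xs))

module _ {A : Set} {R : A → A → Set} (R-sym : Symmetric R) where

  open import Data.List.Membership.Propositional using (_∈_)

  AllPairs-lookup : ∀ {xs} → AllPairs R xs → ∀ {i j} → i ≢ j → R (lookup xs i) (lookup xs j)
  AllPairs-lookup (_ ∷ _) {zero} {zero} i≢j = contradiction refl i≢j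
  AllPairs-lookup (Rx ∷ _) {zero} {suc j} _ = All.lookup Rx (∈-lookup j)
  AllPairs-lookup (Rx ∷ _) {suc i} {zero} _ = R-sym (All.lookup Rx (∈-lookup i))
  AllPairs-lookup (_ ∷ Rxs) {suc i} {suc j} i≢j = AllPairs-lookup Rxs (i≢j ∘ cong suc)

  AllPairs-∈ : ∀ {xs} → AllPairs R xs → ∀ {x y} → x ∈ xs → y ∈ xs → x ≢ y → R x y
  AllPairs-∈ (_ ∷ _) (here refl) (here refl) x≢y = contradiction refl x≢y
  AllPairs-∈ (Rx ∷ _) (here refl) (there y∈) _ = All.lookup Rx y∈
  AllPairs-∈ (Rx ∷ _) (there x∈) (here refl) _ = R-sym (All.lookup Rx x∈)
  AllPairs-∈ (_ ∷ Rxs) (there x∈) (there y∈) x≢y = AllPairs-∈ Rxs x∈ y∈ x≢y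

-- A bipartite multigraph is a list of edges; the edge x joins p x on the left to q x on the right.
module BipartiteMatching {E V : Set} (_≟ᴱ_ : DecidableEquality E) (_≟ⱽ_ : DecidableEquality V) where

  open import Data.List.Membership.Propositional using (_∈_; _∉_; find; lose)
  open import Data.List.Membership.DecPropositional _≟ᴱ_ using () renaming (_∈?_ to _∈ᴱ?_)
  open import Data.List.Membership.DecPropositional _≟ⱽ_ using () renaming (_∈?_ to _∈ⱽ?_)

  Disjoint : (p q : E → V) → E → E → Set
  Disjoint p q x y = p x ≢ p y × q x ≢ q y

  Disjoint-sym : ∀ {p q} → Symmetric (Disjoint p q)
  Disjoint-sym (p≢ , q≢) = ≢-sym p≢ , ≢-sym q≢

  Matching : (p q : E → V) → List E → Set
  Matching p q = AllPairs (Disjoint p q)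

  Matching-≡ : ∀ {p q M x y} → Matching p q M → x ∈ M → y ∈ M → ¬ Disjoint p q x y → x ≡ y
  Matching-≡ {p} {q} {x = x} {y} M# x∈ y∈ ¬x#y with x ≟ᴱ y
  ... | yes x≡y = x≡y
  ... | no x≢y = contradiction (AllPairs-∈ (Disjoint-sym {p} {q}) M# x∈ y∈ x≢y) ¬x#y

  Covers : (p q : E → V) → List V → List V → List E → Set
  Covers p q A B L = ∀ {x} → x ∈ L → p x ∈ A ⊎ q x ∈ B

  record MatchingCover (p q : E → V) (L : List E) : Set where
    constructor matchingCover
    field
      matching       : List E
      matching⊆      : ∀ {x} → x ∈ matching → x ∈ L
      isMatching     : Matching p q matching
      left right     : List V
      covers         : Covers p q left right L
      cover≤matching : length left + length right ≤ length matching

  remove : V → List V → List V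
  remove k = filter (λ y → ¬? (y ≟ⱽ k))

  length-remove : ∀ {k A} → k ∈ A → length (remove k A) < length A
  length-remove {k} {A} k∈A = filter-notAll (λ y → ¬? (y ≟ⱽ k)) A (lose k∈A (λ k≢k → k≢k refl))

  ∈-remove : ∀ {k y A} → y ∈ A → y ≢ k → y ∈ remove k A
  ∈-remove = ∈-filter⁺ (λ y → ¬? (y ≟ⱽ _))

  matching≤cover : ∀ {p q A B M} → Matching p q M → Covers p q A B M →
    length M ≤ length A + length B
  matching≤cover [] _ = z≤n
  matching≤cover {p} {q} {A} {B} {x ∷ _} (x# ∷ M#) cov with cov (here refl)
  ... | inj₁ px∈A =
    ≤-trans (s≤s (matching≤cover M# cov′)) (+-monoˡ-≤ (length B) (length-remove px∈A))
    where
    cov′ : Covers p q (remove (p x) A) B _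
    cov′ y∈M = Sum.map₁ (λ py∈A → ∈-remove py∈A (≢-sym (proj₁ (All.lookup x# y∈M)))) (cov (there y∈M))
  ... | inj₂ qx∈B =
    ≤-trans (s≤s (matching≤cover M# cov′))
      (≤-trans (≤-reflexive (sym (+-suc _ _))) (+-monoʳ-≤ (length A) (length-remove qx∈B)))
    where
    cov′ : Covers p q A (remove (q x) B) _
    cov′ y∈M = Sum.map₂ (λ qy∈B → ∈-remove qy∈B (≢-sym (proj₂ (All.lookup x# y∈M)))) (cov (there y∈M))

  private
    Bounded : ℕ → Set
    Bounded bound = ∀ p q (L : List E) → length L ≤ bound → MatchingCover p q L

  -- Rizzi's inductive step for König's theorem, at the left end a of the first edge e.
  module RizziStep (bound : ℕ) (konig< : Bounded bound) (p q : E → V)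
                   (e : E) (L′ : List E) (L′≤bound : length L′ ≤ bound) where

    L : List E
    L = e ∷ L′

    a b : V
    a = p e
    b = q e

    recurse : ∀ {P : E → Set} (P? : Decidable P) {f} → f ∈ L → ¬ P f →
      ∀ p′ q′ → MatchingCover p′ q′ (filter P? L)
    recurse P? f∈L ¬Pf p′ q′ =
      konig< p′ q′ (filter P? L) (≤-trans (s≤s⁻¹ (filter-notAll P? L (lose f∈L ¬Pf))) L′≤bound)

    off-b? : Decidable (λ x → q x ≢ b)
    off-b? x = ¬? (q x ≟ⱽ b)

    open MatchingCover (recurse off-b? (here refl) (λ b≢b → b≢b refl) p q)
      renaming (matching to M₁; matching⊆ to M₁⊆; isMatching to M₁#; left to A₁; right to B₁;
                covers to covers₁; cover≤matching to cover₁≤M₁)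

    M₁-avoids-b : ∀ {x} → x ∈ M₁ → x ∈ L × q x ≢ b
    M₁-avoids-b = ∈-filter⁻ off-b? ∘ M₁⊆

    cover₁ : Covers p q A₁ (b ∷ B₁) L
    cover₁ {x} x∈L with q x ≟ⱽ b
    ... | yes qx≡b = inj₂ (here qx≡b)
    ... | no qx≢b = Sum.map₂ there (covers₁ (∈-filter⁺ off-b? x∈L qx≢b))

    cover₁-size : length A₁ + length (b ∷ B₁) ≤ suc (length M₁)
    cover₁-size = ≤-trans (≤-reflexive (+-suc _ _)) (s≤s cover₁≤M₁)

    add-e : (∀ {x} → x ∈ M₁ → p x ≢ a) → MatchingCover p q L
    add-e M₁-avoids-a =
      matchingCover (e ∷ M₁) e∷M₁⊆L (All.tabulate e#M₁ ∷ M₁#) A₁ (b ∷ B₁) cover₁ cover₁-size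
      where
      e∷M₁⊆L : ∀ {x} → x ∈ e ∷ M₁ → x ∈ L
      e∷M₁⊆L (here refl) = here refl
      e∷M₁⊆L (there x∈M₁) = proj₁ (M₁-avoids-b x∈M₁)
      e#M₁ : ∀ {y} → y ∈ M₁ → Disjoint p q e y
      e#M₁ y∈M₁ = ≢-sym (M₁-avoids-a y∈M₁) , ≢-sym (proj₂ (M₁-avoids-b y∈M₁))

    -- Deleting an edge f at a unused by M₁: either L - f has a matching larger than M₁, or its
    -- cover contains a and hence also covers f.
    module DeleteEdge {f : E} (f∈L : f ∈ L) (pf≡a : p f ≡ a) (f≢e : f ≢ e) (f∉M₁ : f ∉ M₁) where

      off-f? : Decidable (_≢ f)
      off-f? x = ¬? (x ≟ᴱ f)

      open MatchingCover (recurse off-f? f∈L (λ f≢f → f≢f refl) p q)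
        renaming (matching to M₂; matching⊆ to M₂⊆; isMatching to M₂#; left to A₂; right to B₂;
                  covers to covers₂; cover≤matching to cover₂≤M₂)

      M₂⊆L : ∀ {x} → x ∈ M₂ → x ∈ L
      M₂⊆L = proj₁ ∘ ∈-filter⁻ off-f? ∘ M₂⊆

      cover₂ : a ∈ A₂ → Covers p q A₂ B₂ L
      cover₂ a∈A₂ {x} x∈L with x ≟ᴱ f
      ... | yes refl = inj₁ (subst (_∈ A₂) (sym pf≡a) a∈A₂)
      ... | no x≢f = covers₂ (∈-filter⁺ off-f? x∈L x≢f)

      -- Otherwise e is covered by b, and removing b from the cover leaves a cover of M₁.
      M₁<M₂ : ¬ a ∈ A₂ → length M₁ < length M₂
      M₁<M₂ a∉A₂ with covers₂ (∈-filter⁺ off-f? (here refl) (≢-sym f≢e))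
      ... | inj₁ a∈A₂ = contradiction a∈A₂ a∉A₂
      ... | inj₂ b∈B₂ = begin-strict
        length M₁                         ≤⟨ matching≤cover M₁# cover-M₁ ⟩
        length A₂ + length (remove b B₂)  <⟨ +-monoʳ-< (length A₂) (length-remove b∈B₂) ⟩
        length A₂ + length B₂             ≤⟨ cover₂≤M₂ ⟩
        length M₂                         ∎
        where
        open ≤-Reasoning
        cover-M₁ : Covers p q A₂ (remove b B₂) M₁
        cover-M₁ {y} y∈M₁ with M₁-avoids-b y∈M₁
        ... | y∈L , qy≢b = Sum.map₂ (λ qy∈B₂ → ∈-remove qy∈B₂ qy≢b)
          (covers₂ (∈-filter⁺ off-f? y∈L (λ y≡f → f∉M₁ (subst (_∈ M₁) y≡f y∈M₁))))

      result : MatchingCover p q L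
      result with length M₁ <? length M₂ | a ∈ⱽ? A₂
      ... | yes M₁<M₂′ | _ =
        matchingCover M₂ M₂⊆L M₂# A₁ (b ∷ B₁) cover₁ (≤-trans cover₁-size M₁<M₂′)
      ... | no _ | yes a∈A₂ = matchingCover M₂ M₂⊆L M₂# A₂ B₂ (cover₂ a∈A₂) cover₂≤M₂
      ... | no M₁≮M₂ | no a∉A₂ = contradiction (M₁<M₂ a∉A₂) M₁≮M₂

    -- The edges at a are exactly e and g: contract them, identifying their right ends c and b.
    module ContractEdge {g : E} (g∈L : g ∈ L) (pg≡a : p g ≡ a) (qg≢b : q g ≢ b)
                        (at-a : ∀ {x} → x ∈ L → p x ≡ a → x ≡ e ⊎ x ≡ g) where

      c : V
      c = q g

      merge : V → V
      merge k with k ≟ⱽ c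
      ... | yes _ = b
      ... | no _ = k

      merge-cases : ∀ k → k ≡ c × merge k ≡ b ⊎ k ≢ c × merge k ≡ k
      merge-cases k with k ≟ⱽ c
      ... | yes k≡c = inj₁ (k≡c , refl)
      ... | no k≢c = inj₂ (k≢c , refl)

      merge-c : merge c ≡ b
      merge-c with merge-cases c
      ... | inj₁ (_ , merged) = merged
      ... | inj₂ (c≢c , _) = contradiction refl c≢c

      merge-b : merge b ≡ b
      merge-b with merge-cases b
      ... | inj₁ (b≡c , _) = contradiction (sym b≡c) qg≢b
      ... | inj₂ (_ , kept) = kept

      off-a? : Decidable (λ x → p x ≢ a)
      off-a? x = ¬? (p x ≟ⱽ a)

      open MatchingCover (recurse off-a? (here refl) (λ a≢a → a≢a refl) p (merge ∘ q))
        renaming (matching to M₃; matching⊆ to M₃⊆; isMatching to M₃#; left to A₃; right to B₃;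
                  covers to covers₃; cover≤matching to cover₃≤M₃)

      M₃-avoids-a : ∀ {x} → x ∈ M₃ → x ∈ L × p x ≢ a
      M₃-avoids-a = ∈-filter⁻ off-a? ∘ M₃⊆

      -- If b is used by M₃ then c is not, since merging c into b keeps M₃ a matching.
      extension : ∃ λ z → z ∈ L × All (Disjoint p q z) M₃
      extension with any? (λ y → q y ≟ⱽ b) M₃
      ... | no b-unused = e , here refl ,
        All.tabulate λ y∈M₃ → ≢-sym (proj₂ (M₃-avoids-a y∈M₃)) ,
                              λ b≡qy → b-unused (lose y∈M₃ (sym b≡qy))
      ... | yes b-used with find b-used
      ... | y₀ , y₀∈M₃ , qy₀≡b = g , g∈L ,
        All.tabulate λ y∈M₃ → (λ pg≡py → proj₂ (M₃-avoids-a y∈M₃) (trans (sym pg≡py) pg≡a)) ,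
                              c≢q y∈M₃
        where
        c≢q : ∀ {y} → y ∈ M₃ → c ≢ q y
        c≢q {y} y∈M₃ c≡qy = qg≢b (trans c≡qy (trans (cong q y≡y₀) qy₀≡b))
          where
          y≡y₀ : y ≡ y₀
          y≡y₀ = Matching-≡ M₃# y∈M₃ y₀∈M₃ λ (_ , q′≢) → q′≢ (begin
            merge (q y)   ≡⟨ cong merge (sym c≡qy) ⟩
            merge c       ≡⟨ merge-c ⟩
            b             ≡⟨ sym merge-b ⟩
            merge b       ≡⟨ cong merge (sym qy₀≡b) ⟩
            merge (q y₀)  ∎)
            where open ≡-Reasoning

      M : List E
      M = proj₁ extension ∷ M₃

      M⊆L : ∀ {x} → x ∈ M → x ∈ L
      M⊆L (here refl) = proj₁ (proj₂ extension)
      M⊆L (there x∈M₃) = proj₁ (M₃-avoids-a x∈M₃)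

      M# : Matching p q M
      M# = proj₂ (proj₂ extension) ∷ AllPairs.map (λ (p≢ , q′≢) → p≢ , q′≢ ∘ cong merge) M₃#

      cover-with-c : b ∈ B₃ → Covers p q A₃ (c ∷ B₃) L
      cover-with-c b∈B₃ {x} x∈L with p x ≟ⱽ a
      ... | yes px≡a with at-a x∈L px≡a
      ... | inj₁ refl = inj₂ (there b∈B₃)
      ... | inj₂ refl = inj₂ (here refl)
      cover-with-c b∈B₃ {x} x∈L | no px≢a = Sum.map₂ unmerge (covers₃ (∈-filter⁺ off-a? x∈L px≢a))
        where
        unmerge : merge (q x) ∈ B₃ → q x ∈ c ∷ B₃
        unmerge m∈B₃ with merge-cases (q x)
        ... | inj₁ (qx≡c , _) = here qx≡c
        ... | inj₂ (_ , kept) = there (subst (_∈ B₃) kept m∈B₃)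

      cover-with-a : ¬ b ∈ B₃ → Covers p q (a ∷ A₃) B₃ L
      cover-with-a b∉B₃ {x} x∈L with p x ≟ⱽ a
      ... | yes px≡a = inj₁ (here px≡a)
      ... | no px≢a = Sum.map there unmerge (covers₃ (∈-filter⁺ off-a? x∈L px≢a))
        where
        unmerge : merge (q x) ∈ B₃ → q x ∈ B₃
        unmerge m∈B₃ with merge-cases (q x)
        ... | inj₁ (_ , merged) = contradiction (subst (_∈ B₃) merged m∈B₃) b∉B₃
        ... | inj₂ (_ , kept) = subst (_∈ B₃) kept m∈B₃

      result : MatchingCover p q L
      result with b ∈ⱽ? B₃
      ... | yes b∈B₃ = matchingCover M M⊆L M# A₃ (c ∷ B₃) (cover-with-c b∈B₃)
                         (≤-trans (≤-reflexive (+-suc _ _)) (s≤s cover₃≤M₃))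
      ... | no b∉B₃ = matchingCover M M⊆L M# (a ∷ A₃) B₃ (cover-with-a b∉B₃) (s≤s cover₃≤M₃)

    step : MatchingCover p q L
    step with any? (λ x → (p x ≟ⱽ a) ×-dec ¬? (q x ≟ⱽ b)) L
    ... | no ¬second = add-e λ x∈M₁ px≡a →
          ¬second (lose (proj₁ (M₁-avoids-b x∈M₁)) (px≡a , proj₂ (M₁-avoids-b x∈M₁)))
    ... | yes second with find second
    ... | g , g∈L , pg≡a , qg≢b with any? (λ x → (p x ≟ⱽ a) ×-dec (¬? (x ≟ᴱ e) ×-dec ¬? (x ≟ᴱ g))) L
    ... | yes third = delete-one (find third)
      where
      g≢e : g ≢ e
      g≢e g≡e = qg≢b (cong q g≡e)
      -- g and h both lie at a, so the matching M₁ misses one of them.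
      delete-one : ∃ (λ h → h ∈ L × p h ≡ a × h ≢ e × h ≢ g) → MatchingCover p q L
      delete-one (h , h∈L , ph≡a , h≢e , h≢g) with g ∈ᴱ? M₁
      ... | no g∉M₁ = DeleteEdge.result g∈L pg≡a g≢e g∉M₁
      ... | yes g∈M₁ = DeleteEdge.result h∈L ph≡a h≢e λ h∈M₁ →
            h≢g (Matching-≡ M₁# h∈M₁ g∈M₁ λ (p≢ , _) → p≢ (trans ph≡a (sym pg≡a)))
    ... | no ¬third = ContractEdge.result g∈L pg≡a qg≢b only-e-g
      where
      only-e-g : ∀ {x} → x ∈ L → p x ≡ a → x ≡ e ⊎ x ≡ g
      only-e-g {x} x∈L px≡a with x ≟ᴱ e | x ≟ᴱ g
      ... | yes x≡e | _ = inj₁ x≡e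
      ... | no _ | yes x≡g = inj₂ x≡g
      ... | no x≢e | no x≢g = contradiction (lose x∈L (px≡a , x≢e , x≢g)) ¬third

  konig-bounded : ∀ bound → Bounded bound
  konig-bounded _ p q [] _ = matchingCover [] (λ ()) [] [] [] (λ ()) z≤n
  konig-bounded (suc bound) p q (e ∷ L′) (s≤s L′≤bound) =
    RizziStep.step bound (konig-bounded bound) p q e L′ L′≤bound

  konig : ∀ p q L → MatchingCover p q L
  konig p q L = konig-bounded (length L) p q L ≤-refl

  FiberBound : (E → V) → ℕ → List E → Set
  FiberBound f Δ L = ∀ k → length (filter (λ x → f x ≟ⱽ k) L) ≤ Δ

  FiberBound-filter : ∀ {f Δ L} {P : E → Set} (P? : Decidable P) →
    FiberBound f Δ L → FiberBound f Δ (filter P? L)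
  FiberBound-filter {f} {L = L} P? bound k =
    ≤-trans (length-mono-≤ (filter⁺ fiber? fiber? (λ { refl fx≡k → fx≡k }) (filter-⊆ P? L))) (bound k)
    where
    fiber? : Decidable (λ x → f x ≡ k)
    fiber? x = f x ≟ⱽ k

  length≤fibers : ∀ {f Δ} C L → FiberBound f Δ L → (∀ {x} → x ∈ L → f x ∈ C) →
    length L ≤ length C * Δ
  length≤fibers [] [] _ _ = z≤n
  length≤fibers [] (x ∷ L) _ in-C with in-C (here refl)
  ... | ()
  length≤fibers {f} {Δ} (k ∷ C) L bound in-C = begin
    length L                                                  ≡⟨ sym (length-filter+filter-∁ fiber? L) ⟩
    length (filter fiber? L) + length (filter (∁? fiber?) L)  ≤⟨ +-mono-≤ (bound k) rest ⟩
    Δ + length C * Δ                                          ∎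
    where
    open ≤-Reasoning
    fiber? : Decidable (λ x → f x ≡ k)
    fiber? x = f x ≟ⱽ k
    in-C′ : ∀ {x} → x ∈ filter (∁? fiber?) L → f x ∈ C
    in-C′ x∈ with ∈-filter⁻ (∁? fiber?) x∈
    ... | x∈L , fx≢k with in-C x∈L
    ... | here fx≡k = contradiction fx≡k fx≢k
    ... | there fx∈C = fx∈C
    rest : length (filter (∁? fiber?) L) ≤ length C * Δ
    rest = length≤fibers C _ (FiberBound-filter {f} {Δ} {L} (∁? fiber?) bound) in-C′

  length≤cover*Δ : ∀ {p q Δ A B L} → Covers p q A B L → FiberBound p Δ L → FiberBound q Δ L →
    length L ≤ (length A + length B) * Δ
  length≤cover*Δ {p} {q} {Δ} {A} {B} {L} cover p-bound q-bound = begin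
    length L                                                ≡⟨ sym (length-filter+filter-∁ left? L) ⟩
    length (filter left? L) + length (filter (∁? left?) L)  ≤⟨ +-mono-≤ left-part right-part ⟩
    length A * Δ + length B * Δ                             ≡⟨ sym (*-distribʳ-+ Δ (length A) (length B)) ⟩
    (length A + length B) * Δ                               ∎
    where
    open ≤-Reasoning
    left? : Decidable (λ x → p x ∈ A)
    left? x = p x ∈ⱽ? A
    left-part : length (filter left? L) ≤ length A * Δ
    left-part =
      length≤fibers A _ (FiberBound-filter {p} {Δ} {L} left? p-bound) (proj₂ ∘ ∈-filter⁻ left? {xs = L})
    in-B : ∀ {x} → x ∈ filter (∁? left?) L → q x ∈ B
    in-B x∈ with ∈-filter⁻ (∁? left?) x∈
    ... | x∈L , px∉A = Sum.[ (λ px∈A → contradiction px∈A px∉A) , (λ qx∈B → qx∈B) ]′ (cover x∈L)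
    right-part : length (filter (∁? left?) L) ≤ length B * Δ
    right-part = length≤fibers B _ (FiberBound-filter {q} {Δ} {L} (∁? left?) q-bound) in-B

  -- By König's theorem some matching M has a cover by |M| vertices, which meets at most |M| Δ edges.
  large-matching : ∀ {p q Δ} t L → FiberBound p Δ L → FiberBound q Δ L → (t ∸ 1) * Δ + 1 ≤ length L →
    Σ (Fin t → E) λ b → (∀ j → b j ∈ L) × (∀ {j j′} → j ≢ j′ → Disjoint p q (b j) (b j′))
  large-matching {p} {q} {Δ} t L p-bound q-bound large = extract (konig p q L)
    where
    extract : MatchingCover p q L →
      Σ (Fin t → E) λ b → (∀ j → b j ∈ L) × (∀ {j j′} → j ≢ j′ → Disjoint p q (b j) (b j′))
    extract (matchingCover M M⊆L M# A B cover A+B≤M) with t ≤? length M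
    ... | yes t≤M = (λ j → lookup M (inject≤ j t≤M)) , (λ j → M⊆L (∈-lookup (inject≤ j t≤M))) ,
      λ j≢j′ → AllPairs-lookup (Disjoint-sym {p} {q}) M# (j≢j′ ∘ inject≤-injective t≤M t≤M _ _)
    ... | no t≰M = ⊥-elim (<-irrefl refl (begin-strict
      (t ∸ 1) * Δ                <⟨ subst (_≤ length L) (+-comm _ 1) large ⟩
      length L                   ≤⟨ length≤cover*Δ cover p-bound q-bound ⟩
      (length A + length B) * Δ  ≤⟨ *-monoˡ-≤ Δ A+B≤M ⟩
      length M * Δ               ≤⟨ *-monoˡ-≤ Δ M≤t∸1 ⟩
      (t ∸ 1) * Δ                ∎))
      where
      open ≤-Reasoning
      M≤t∸1 : length M ≤ t ∸ 1
      M≤t∸1 = subst (length M ≤_) (pred[m∸n]≡m∸[1+n] t 0) (<⇒≤pred (≰⇒> t≰M))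

open import Data.Fin.Subset using (Subset; _∈_; _∉_; ∣_∣; _-_; inside; outside)
open import Data.Fin.Subset.Properties using (_∈?_; x∈p∧x≢y⇒x∈p-y; x∈p⇒∣p-x∣<∣p∣)
open import Data.List.Membership.Propositional using () renaming (_∈_ to _∈ₗ_)

elements : ∀ {n} → Subset n → List (Fin n)
elements {n} p = filter (_∈? p) (allFin n)

elements-unique : ∀ {n} (p : Subset n) → Unique (elements p)
elements-unique {n} p = Unique.filter⁺ (_∈? p) (allFin⁺ n)

∈-elements⁻ : ∀ {n} {p : Subset n} {x} → x ∈ₗ elements p → x ∈ p
∈-elements⁻ {n} {p} = proj₂ ∘ ∈-filter⁻ (_∈? p) {xs = allFin n}

private
  filter-∈?-map-suc : ∀ {n} s (p : Subset n) xs →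
    filter (_∈? (s ∷ p)) (map suc xs) ≡ map suc (filter (_∈? p) xs)
  filter-∈?-map-suc s p [] = refl
  filter-∈?-map-suc s p (x ∷ xs) with x ∈? p
  ... | yes _ = cong (suc x ∷_) (filter-∈?-map-suc s p xs)
  ... | no _ = filter-∈?-map-suc s p xs

  length-elements-∷ : ∀ {n} s (p : Subset n) →
    length (filter (_∈? (s ∷ p)) (tabulate suc)) ≡ length (elements p)
  length-elements-∷ {n} s p = begin
    length (filter (_∈? (s ∷ p)) (tabulate suc))
      ≡⟨ cong (length ∘ filter (_∈? (s ∷ p))) (sym (map-tabulate (λ i → i) suc)) ⟩
    length (filter (_∈? (s ∷ p)) (map suc (allFin n)))
      ≡⟨ cong length (filter-∈?-map-suc s p (allFin n)) ⟩
    length (map suc (elements p))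
      ≡⟨ length-map suc (elements p) ⟩
    length (elements p)
      ∎
    where open ≡-Reasoning

length-elements : ∀ {n} (p : Subset n) → length (elements p) ≡ ∣ p ∣
length-elements [] = refl
length-elements (inside ∷ p) = cong suc (trans (length-elements-∷ inside p) (length-elements p))
length-elements (outside ∷ p) = trans (length-elements-∷ outside p) (length-elements p)

length≤∣_∣ : ∀ {n} (p : Subset n) {xs} → Unique xs → (∀ {x} → x ∈ₗ xs → x ∈ p) →
  length xs ≤ ∣ p ∣
length≤∣ p ∣ {[]} _ _ = z≤n
length≤∣ p ∣ {x ∷ xs} (x∉xs ∷ xs-unique) ⊆p =
  ≤-<-trans
    (length≤∣ p - x ∣ xs-unique λ y∈xs → x∈p∧x≢y⇒x∈p-y (⊆p (there y∈xs)) (≢-sym (All.lookup x∉xs y∈xs)))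
    (x∈p⇒∣p-x∣<∣p∣ (⊆p (here refl)))

length≤pred∣_∣ : ∀ {n} (p : Subset n) {z xs} → Unique xs →
  (∀ {x} → x ∈ₗ xs → x ∈ p × z ∈ p × x ≢ z) → length xs ≤ pred ∣ p ∣
length≤pred∣ p ∣ {xs = []} _ _ = z≤n
length≤pred∣ p ∣ {z} {x ∷ xs} xs-unique h = <⇒≤pred (≤-<-trans
  (length≤∣ p - z ∣ xs-unique λ y∈ → x∈p∧x≢y⇒x∈p-y (proj₁ (h y∈)) (proj₂ (proj₂ (h y∈))))
  (x∈p⇒∣p-x∣<∣p∣ (proj₁ (proj₂ (h (here refl))))))

module Spokes {n r} (H : Hypergraph n r) (W : Subset n) (default : Fin (m H)) where

  open BipartiteMatching (_≟ᶠ_ {n}) (_≟ᶠ_ {m H}) using (FiberBound)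

  AdjacentToAll : Fin n → Set
  AdjacentToAll z = ∀ x → x ∈ W → InN H z x

  -- The edge l_zx, with a junk value outside W.
  l : ∀ {z} → AdjacentToAll z → Fin n → Fin (m H)
  l hz x with x ∈? W
  ... | yes x∈W = proj₁ (proj₂ (hz x x∈W))
  ... | no _ = default

  l-IsL : ∀ {z} (hz : AdjacentToAll z) {x} → x ∈ W → IsL H z x (l hz x)
  l-IsL hz {x} x∈W with x ∈? W
  ... | yes x∈W′ = proj₁ (hz x x∈W′) , proj₂ (proj₂ (hz x x∈W′))
  ... | no x∉W = contradiction x∈W x∉W

  -- The vertices x of W with l_zx = k lie in the edge k and differ from z ∈ k.
  l-fiber : ∀ {z} (hz : AdjacentToAll z) → FiberBound (l hz) (r ∸ 1) (elements W)
  l-fiber {z} hz k = subst (length fiber ≤_) (trans (cong pred (uniform H k)) (pred[m∸n]≡m∸[1+n] r 0))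
    (length≤pred∣ edge H k ∣ (Unique.filter⁺ fiber? (elements-unique W)) in-k)
    where
    fiber? = λ x → l hz x ≟ᶠ k
    fiber = filter fiber? (elements W)
    in-k : ∀ {x} → x ∈ₗ fiber → x ∈ edge H k × z ∈ edge H k × x ≢ z
    in-k x∈ with ∈-filter⁻ fiber? {xs = elements W} x∈
    ... | x∈W , refl with l-IsL hz (∈-elements⁻ x∈W)
    ... | z≢x , z∈ , x∈ = x∈ , z∈ , ≢-sym z≢x

triple : {A : Set} → A → A → A → Fin 3 → A
triple x y z zero = x
triple x y z (suc zero) = y
triple x y z (suc (suc zero)) = z

triple-pairwise : ∀ {A : Set} {R : A → A → Set} → Symmetric R → ∀ {x y z} → R x y → R x z → R y z →
  ∀ {i j} → i ≢ j → R (triple x y z i) (triple x y z j)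
triple-pairwise R-sym Rxy Rxz Ryz {zero} {zero} i≢j = contradiction refl i≢j
triple-pairwise R-sym Rxy Rxz Ryz {zero} {suc zero} _ = Rxy
triple-pairwise R-sym Rxy Rxz Ryz {zero} {suc (suc zero)} _ = Rxz
triple-pairwise R-sym Rxy Rxz Ryz {suc zero} {zero} _ = R-sym Rxy
triple-pairwise R-sym Rxy Rxz Ryz {suc zero} {suc zero} i≢j = contradiction refl i≢j
triple-pairwise R-sym Rxy Rxz Ryz {suc zero} {suc (suc zero)} _ = Ryz
triple-pairwise R-sym Rxy Rxz Ryz {suc (suc zero)} {zero} _ = R-sym Rxz
triple-pairwise R-sym Rxy Rxz Ryz {suc (suc zero)} {suc zero} _ = R-sym Ryz
triple-pairwise R-sym Rxy Rxz Ryz {suc (suc zero)} {suc (suc zero)} i≢j = contradiction refl i≢j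

distinct⇒injective : ∀ {k} {A : Set} {f : Fin k → A} → (∀ {i j} → i ≢ j → f i ≢ f j) →
  Injective _≡_ _≡_ f
distinct⇒injective f-distinct {i} {j} fi≡fj with i ≟ᶠ j
... | yes i≡j = i≡j
... | no i≢j = contradiction fi≡fj (f-distinct i≢j)

module _ {n r} (H : Hypergraph n r) where

  Separated : Fin n → Fin n → Fin n → Set
  Separated x c c′ = ∀ i → c ∈ edge H i → c′ ∈ edge H i → x ∉ edge H i

  Separated-sym : ∀ {x} → Symmetric (Separated x)
  Separated-sym sep i c′∈ c∈ = sep i c∈ c′∈

  ¬InL⇒Separated : ∀ {x c c′} → c ≢ c′ → ¬ InL H c c′ x → Separated x c c′
  ¬InL⇒Separated c≢c′ x∉l i c∈ c′∈ x∈ = x∉l (i , (c≢c′ , c∈ , c′∈) , x∈)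

  bergeK3t : ∀ {t} (a : Fin 3 → Fin n) (b : Fin t → Fin n) (ℓ : Fin 3 → Fin n → Fin (m H)) →
    (∀ {i i′} → i ≢ i′ → a i ≢ a i′) →
    (∀ i j → IsL H (a i) (b j) (ℓ i (b j))) →
    (∀ i {j j′} → j ≢ j′ → ℓ i (b j) ≢ ℓ i (b j′)) →
    (∀ j {i i′} → i ≢ i′ → Separated (b j) (a i) (a i′)) →
    ContainsBergeK3 H t
  bergeK3t a b ℓ a-distinct ℓ-spec ℓ-distinct separated =
    a , b , φ , distinct⇒injective a-distinct , distinct⇒injective b-distinct ,
    (λ i j → proj₁ (ℓ-spec i j)) , φ-injective , (λ i j → proj₂ (ℓ-spec i j))
    where
    φ : Fin 3 → _ → Fin (m H)
    φ i j = ℓ i (b j)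
    b-distinct : ∀ {j j′} → j ≢ j′ → b j ≢ b j′
    b-distinct j≢j′ bj≡bj′ = ℓ-distinct zero j≢j′ (cong (ℓ zero) bj≡bj′)
    φ-injective : ∀ i j i′ j′ → φ i j ≡ φ i′ j′ → i ≡ i′ × j ≡ j′
    φ-injective i j i′ j′ φ≡ with i ≟ᶠ i′ | j ≟ᶠ j′
    ... | yes refl | yes refl = refl , refl
    ... | yes refl | no j≢j′ = contradiction φ≡ (ℓ-distinct i j≢j′)
    ... | no i≢i′ | _ with ℓ-spec i j | ℓ-spec i′ j′
    ... | _ , ai∈ , bj∈ | _ , ai′∈ , _ =
      ⊥-elim (separated j i≢i′ (φ i j) ai∈ (subst (λ k → a i′ ∈ edge H k) (sym φ≡) ai′∈) bj∈)

theorem2p1 : (n r t : ℕ) → 3 ≤ r → r ≤ n → 3 ≤ t →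
  (H : Hypergraph n r) → Linear H →
  (u w v : Fin n) → Adjacent H u w → InN H u v → v ≢ w →
  (W : Subset n) →
  (∀ x → x ∈ W → InN H v x × InN H u x × InN H w x) →
  (∀ x → x ∈ W → ¬ InL H v u x × ¬ InL H v w x × ¬ InL H u w x) →
  (∀ u₁ u₂ → u₁ ∈ W → u₂ ∈ W → u₁ ≢ u₂ →
     ∀ i j → IsL H v u₁ i → IsL H v u₂ j → i ≢ j) →
  (t ∸ 1) * (r ∸ 1) + 1 ≤ ∣ W ∣ →
  ContainsBergeK3 H t
theorem2p1 n r t _ _ _ H _ u w v (u≢w , d , _) (u≢v , _) v≢w W adjacent avoids l-v-distinct large =
  bergeK3t H a b ℓ (triple-pairwise ≢-sym {v} {u} {w} (≢-sym u≢v) v≢w u≢w)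
    (λ i j → l-IsL (centre i) (b∈W j)) ℓ-distinct (λ j → separated (avoids (b j) (b∈W j)))
  where
  open Spokes H W d
  open BipartiteMatching (_≟ᶠ_ {n}) (_≟ᶠ_ {m H}) using (large-matching)
  a = triple v u w
  centre : ∀ i → AdjacentToAll (a i)
  centre zero x x∈W = proj₁ (adjacent x x∈W)
  centre (suc zero) x x∈W = proj₁ (proj₂ (adjacent x x∈W))
  centre (suc (suc zero)) x x∈W = proj₂ (proj₂ (adjacent x x∈W))
  ℓ : Fin 3 → Fin n → Fin (m H)
  ℓ i = l (centre i)
  matching = large-matching t (elements W) (l-fiber (centre (suc zero))) (l-fiber (centre (suc (suc zero))))
    (subst ((t ∸ 1) * (r ∸ 1) + 1 ≤_) (sym (length-elements W)) large)
  b = proj₁ matching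
  b∈W : ∀ j → b j ∈ W
  b∈W j = ∈-elements⁻ (proj₁ (proj₂ matching) j)
  ℓ-distinct : ∀ i {j j′} → j ≢ j′ → ℓ i (b j) ≢ ℓ i (b j′)
  ℓ-distinct zero {j} {j′} j≢j′ = l-v-distinct (b j) (b j′) (b∈W j) (b∈W j′)
    (λ bj≡bj′ → ℓ-distinct (suc zero) j≢j′ (cong (ℓ (suc zero)) bj≡bj′)) _ _
    (l-IsL (centre zero) (b∈W j)) (l-IsL (centre zero) (b∈W j′))
  ℓ-distinct (suc zero) j≢j′ = proj₁ (proj₂ (proj₂ matching) j≢j′)
  ℓ-distinct (suc (suc zero)) j≢j′ = proj₂ (proj₂ (proj₂ matching) j≢j′)
  separated : ∀ {x} → ¬ InL H v u x × ¬ InL H v w x × ¬ InL H u w x →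
    ∀ {i i′} → i ≢ i′ → Separated H x (a i) (a i′)
  separated (x∉l-vu , x∉l-vw , x∉l-uw) = triple-pairwise (Separated-sym H) {v} {u} {w}
    (¬InL⇒Separated H (≢-sym u≢v) x∉l-vu) (¬InL⇒Separated H v≢w x∉l-vw)
    (¬InL⇒Separated H u≢w x∉l-uw)
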